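{- Let $d \geq 2$ and $\psi_{\mathbf{a}} \in \mathscr{P}_d$. If $0 \notin \mathrm{Prep}_{\mathbb{Q}}(\psi_{\mathbf{a}})$, then for no $n \geq 1$ is the iterate $\psi_{\mathbf{a}}^n$ conjugate to a monomial $z^m$ ($m \geq 1$), to a Chebyshev polynomial $C_\ell$ ($\ell \geq 1$), or to a negative Chebyshev polynomial $-C_\ell$ ($\ell \geq 1$).
   Context: Let $d \geq 2$. Let $\mathscr{P}_d$ be the set of polynomials $\psi_{\mathbf{a}} \in \mathbb{Q}[z]$ indexed by $\mathbf{a} = (a_d, a_{d-2}, \dots, a_1, a_0) \in \mathbb{Z}^d$ with $\gcd(a_d,a_{d-2},\dots,a_0)=1$, $a_d \neq 0$, $a_0 > 0$, where $\psi_{\mathbf{a}}(z) = \frac{a_d}{a_0} z^d + \frac{a_{d-2}}{a_0} z^{d-2} + \cdots + \frac{a_1}{a_0} z + 1$. $\psi^n$ is the $n$-th iterate and $\mathrm{Prep}_{\mathbb{Q}}(\psi_{\mathbf{a}})$ is the set of $z \in \mathbb{Q}$ with $\psi_{\mathbf{a}}^{\ell+m}(z) = \psi_{\mathbf{a}}^\ell(z)$ for some $\ell \geq 0$, $m \geq 1$. Two polynomials $f, g$ are conjugate if there is $(\alpha,\beta) \in \overline{\mathbb{Q}}^{\times} \times \overline{\mathbb{Q}}$ with $g(z) = f(\alpha z + \beta)/\alpha - \beta/\alpha$. For $\ell \geq 1$, the $\ell$-th Chebyshev polynomial $C_\ell \in \mathbb{Z}[z]$ is the unique polynomial with $C_\ell(z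 + 1/z) = z^\ell + 1/z^\ell$. -}

module Defs where

open import Level using (Level; _⊔_)
open import Data.Nat as ℕ using (ℕ; zero; suc)
open import Data.Nat.GCD using (gcd)
open import Data.Integer as ℤ using (ℤ; +_; ∣_∣)
open import Data.Rational as ℚ using (ℚ)
open import Data.Fin using (Fin; toℕ)
open import Data.List using (List; []; _∷_; map; foldr)
open import Data.List using (allFin) renaming (map to lmap)
open import Data.Product using (Σ; _×_; ∃; ∃-syntax)
open import Relation.Nullary using (¬_)
open import Relation.Binary.PropositionalEquality using (_≡_)
open import Algebra.Bundles using (CommutativeRing)

iter : ∀ {a} {A : Set a} → ℕ → (A → A) → A → A
iter zero    f x = x
iter (suc n) f x = f (iter n f x)

-- A parameter vector is given as the coefficient
-- function  a : Fin (suc d) → ℤ,  a i = coefficient a_i of z^i,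
-- together with the constraint a_{d-1} = 0 (the paper's vector
-- (a_d, a_{d-2}, ..., a_0) simply omits this coefficient).

gcdCoeffs : (d : ℕ) → (Fin (suc d) → ℤ) → ℕ
gcdCoeffs d a = foldr (λ i g → gcd ∣ a i ∣ g) 0 (allFin (suc d))

record InP (d : ℕ) (a : Fin (suc d) → ℤ) : Set where
  field
    noSubleading : ∀ i → toℕ i ≡ ℕ.pred d → a i ≡ + 0
    coprime      : gcdCoeffs d a ≡ 1
    leadingNZ    : ∀ i → toℕ i ≡ d → ¬ (a i ≡ + 0)
    constPos     : ∀ i → toℕ i ≡ 0 → ℤ.0ℤ ℤ.< a i

a₀ : (d : ℕ) → (Fin (suc d) → ℤ) → ℤ
a₀ d a = a Fin.zero
  where import Data.Fin as Fin

-- x / y as a rational number, for y > 0 (junk value 0 otherwise;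
-- only used with y = a_0 > 0)
ratio : ℤ → ℤ → ℚ
ratio x (+ suc n) = x ℚ./ suc n
ratio x _         = ℚ.0ℚ

coeffsℚ : (d : ℕ) → (Fin (suc d) → ℤ) → List ℚ
coeffsℚ d a = lmap (λ i → ratio (a i) (a₀ d a)) (allFin (suc d))

hornerℚ : List ℚ → ℚ → ℚ
hornerℚ []       z = ℚ.0ℚ
hornerℚ (c ∷ cs) z = c ℚ.+ z ℚ.* hornerℚ cs z

ψℚ : (d : ℕ) → (Fin (suc d) → ℤ) → ℚ → ℚ
ψℚ d a = hornerℚ (coeffsℚ d a)

Preperiodic : (d : ℕ) → (Fin (suc d) → ℤ) → ℚ → Set
Preperiodic d a z =
  ∃[ l ] ∃[ m ] (1 ℕ.≤ m × iter (l ℕ.+ m) (ψℚ d a) z ≡ iter l (ψℚ d a) z)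

-- An algebraic closure of ℚ: a field F (commutative ring in which
-- 1 ≉ 0 and every nonzero element is invertible), with a ring
-- homomorphism ι : ℚ → F, which is algebraically closed and
-- algebraic over ι(ℚ).  Any such structure is (isomorphic to) ℚ̄.

module _ {c ℓ : Level} (R : CommutativeRing c ℓ) where
  open CommutativeRing R

  horner : List Carrier → Carrier → Carrier
  horner []       z = 0#
  horner (k ∷ ks) z = k + z * horner ks z

  -- last coefficient (leading coefficient for ascending lists); 0 for []
  lastCoeff : List Carrier → Carrier
  lastCoeff []           = 0#
  lastCoeff (k ∷ [])     = k
  lastCoeff (k ∷ l ∷ ks) = lastCoeff (l ∷ ks)

  pow : Carrier → ℕ → Carrier
  pow z zero    = 1#
  pow z (suc n) = z * pow z n

  cheb : ℕ → Carrier → Carrier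
  cheb zero          z = 1# + 1#
  cheb (suc zero)    z = z
  cheb (suc (suc l)) z = z * cheb (suc l) z - cheb l z

  -- g is conjugate to f over R:  ∃ α ≠ 0, β  with
  -- g(z) = f(αz+β)/α − β/α  for all z, written multiplied out by α.
  Conjugate : (Carrier → Carrier) → (Carrier → Carrier) → Set (c ⊔ ℓ)
  Conjugate f g = ∃[ α ] ∃[ β ]
    (¬ (α ≈ 0#) × (∀ z → (α * g z) + β ≈ f ((α * z) + β)))

record AlgClosureℚ (c ℓ : Level) : Set (Level.suc (c ⊔ ℓ)) where
  field
    F : CommutativeRing c ℓ
  open CommutativeRing F
  field
    nontrivial : ¬ (1# ≈ 0#)
    inverse    : ∀ x → ¬ (x ≈ 0#) → ∃[ y ] (x * y ≈ 1#)
    ι     : ℚ → Carrier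
    ι-1   : ι ℚ.1ℚ ≈ 1#
    ι-+   : ∀ p q → ι (p ℚ.+ q) ≈ ι p + ι q
    ι-*   : ∀ p q → ι (p ℚ.* q) ≈ ι p * ι q
    algClosed : ∀ (k₀ k₁ : Carrier) (ks : List Carrier) →
                ¬ (lastCoeff F (k₀ ∷ k₁ ∷ ks) ≈ 0#) →
                ∃[ z ] (horner F (k₀ ∷ k₁ ∷ ks) z ≈ 0#)
    algebraic : ∀ x → ∃[ qs ] (¬ (lastCoeff F (map ι qs) ≈ 0#) ×
                               horner F (map ι qs) x ≈ 0#)

module _ {c ℓ : Level} (K : AlgClosureℚ c ℓ) where
  open AlgClosureℚ K
  open CommutativeRing F

  ψK : (d : ℕ) → (Fin (suc d) → ℤ) → Carrier → Carrier
  ψK d a = horner F (map ι (coeffsℚ d a))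

-- The iterate f = ψ_a^n has degree at least 2 and, like ψ_a (since a_{d-1} = 0),
-- no term of the second-highest degree; the same holds for z^m, C_l and -C_l.  Comparing the two
-- top coefficients of α g(z) + β = f(α z + β) shows β = 0 in characteristic zero, so
-- f(α z) = α g(z).  For each such g the orbit of 0 reaches a fixed point in two steps, hence
-- f³(0) = f²(0); as ψ_a has rational coefficients and ℚ → K is injective, 0 ∈ Prep_ℚ(ψ_a).
-- Coefficients are compared through polynomial functions on K using finite differences.

module Submission where

open import Level using (Level; _⊔_)
open import Data.Nat as ℕ using (ℕ; zero; suc; _≤_; z≤n; s≤s)
import Data.Nat.Properties as ℕP
open import Data.Integer as ℤ using (ℤ)
import Data.Integer.Properties as ℤP
import Data.Integer.GCD as ℤGCD
open import Data.Rational as ℚ using (0ℚ)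
import Data.Rational.Properties as ℚP
open import Data.Fin as Fin using (Fin)
import Data.Fin.Properties as FinP
open import Data.List as List using (List; []; _∷_)
import Data.List.Properties as ListP
open import Data.Maybe using (Maybe; just; nothing)
open import Data.Product using (_×_; _,_; proj₂; ∃-syntax)
open import Data.Sum using (_⊎_; inj₁; inj₂)
open import Data.Empty using (⊥-elim)
open import Function using (_∘_)
open import Relation.Nullary using (¬_; yes; no)
open import Relation.Binary.Definitions using (tri<; tri≈; tri>)
open import Relation.Binary.PropositionalEquality as ≡ using (_≡_)
open import Algebra.Bundles using (CommutativeRing)
import Algebra.Solver.Ring.AlmostCommutativeRing as ACR
import Algebra.Properties.Semiring.Mult as Mult
import Algebra.Properties.Group as GroupProperties
open import Defs

iter-+ : ∀ {a} {A : Set a} (f : A → A) m n x → iter (m ℕ.+ n) f x ≡ iter m f (iter n f x)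
iter-+ f zero    n x = ≡.refl
iter-+ f (suc m) n x = ≡.cong f (iter-+ f m n x)

iter-* : ∀ {a} {A : Set a} (f : A → A) j m x → iter (j ℕ.* m) f x ≡ iter j (iter m f) x
iter-* f zero    m x = ≡.refl
iter-* f (suc j) m x = ≡.trans (iter-+ f m (j ℕ.* m) x) (≡.cong (iter m f) (iter-* f j m x))

ratio-zero : ∀ y → ratio (ℤ.+ 0) y ≡ 0ℚ
ratio-zero (ℤ.+ zero)  = ≡.refl
ratio-zero (ℤ.+ suc n) = ℚP.0/n≡0 (suc n)
ratio-zero ℤ.-[1+ n ]  = ≡.refl

ratio-nonzero : ∀ x y → ℤ.0ℤ ℤ.< y → ¬ (x ≡ ℤ.+ 0) → ¬ (ratio x y ≡ 0ℚ)
ratio-nonzero x (ℤ.+ suc n) _ x≢0 x/y≡0 = x≢0 (begin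
  x                                        ≡⟨ ℚP.↥-/ x (suc n) ⟨
  ℚ.↥ (x ℚ./ suc n) ℤ.* ℤGCD.gcd x (ℤ.+ suc n)  ≡⟨ ≡.cong (λ q → ℚ.↥ q ℤ.* ℤGCD.gcd x (ℤ.+ suc n)) x/y≡0 ⟩
  ℤ.0ℤ ℤ.* ℤGCD.gcd x (ℤ.+ suc n)          ≡⟨ ℤP.*-zeroˡ (ℤGCD.gcd x (ℤ.+ suc n)) ⟩
  ℤ.+ 0                                    ∎)
  where open ≡.≡-Reasoning
ratio-nonzero x (ℤ.+ zero) (ℤ.+<+ ()) _

module Polynomials {c ℓ : Level} (K : AlgClosureℚ c ℓ) where
  open AlgClosureℚ K
  open CommutativeRing F hiding (zero)
  open import Algebra.Properties.Ring ring using (x+x≈x⇒x≈0; x∙y⁻¹≈ε⇒x≈y; +-inverseˡ-unique; -‿involutive; -0#≈0#; -1*x≈-x)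
  open Mult semiring using (×-congʳ; ×-comm-*; ×-assoc-*; ×-homo-1) renaming (_×_ to _×ᴿ_)
  open Mult (CommutativeRing.semiring ℚP.+-*-commutativeRing) using () renaming (_×_ to _×ℚ_)
  open import Relation.Binary.Reasoning.Setoid setoid
  open import Algebra.Definitions _≈_ using (Congruent₁)

  ι-0 : ι 0ℚ ≈ 0#
  ι-0 = x+x≈x⇒x≈0 _ (sym (ι-+ 0ℚ 0ℚ))

  ι-neg : ∀ q → ι (ℚ.- q) ≈ - ι q
  ι-neg q = +-inverseˡ-unique _ _ (begin
    ι (ℚ.- q) + ι q  ≈⟨ ι-+ (ℚ.- q) q ⟨
    ι (ℚ.- q ℚ.+ q)  ≡⟨ ≡.cong ι (ℚP.+-inverseˡ q) ⟩
    ι 0ℚ           ≈⟨ ι-0 ⟩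
    0#               ∎)

  ι-morphism : ℚ.+-*-rawRing ACR.-Raw-AlmostCommutative⟶ ACR.fromCommutativeRing F
  ι-morphism = record
    { ⟦_⟧ = ι ; +-homo = ι-+ ; *-homo = ι-* ; -‿homo = ι-neg ; 0-homo = ι-0 ; 1-homo = ι-1 }

  ι-≟ : ∀ p q → Maybe (ι p ≈ ι q)
  ι-≟ p q with p ℚP.≟ q
  ... | yes ≡.refl = just refl
  ... | no _       = nothing

  open import Algebra.Solver.Ring ℚ.+-*-rawRing (ACR.fromCommutativeRing F) ι-morphism ι-≟

  ι-nonzero : ∀ q → ¬ (q ≡ 0ℚ) → ι q ≉ 0#
  ι-nonzero q q≢0 ιq≈0 = nontrivial (begin
    1#                   ≈⟨ ι-1 ⟨
    ι ℚ.1ℚ               ≡⟨ ≡.cong ι (ℚP.*-inverseʳ q) ⟨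
    ι (q ℚ.* ℚ.1/ q)     ≈⟨ ι-* q (ℚ.1/ q) ⟩
    ι q * ι (ℚ.1/ q)     ≈⟨ *-congʳ ιq≈0 ⟩
    0# * ι (ℚ.1/ q)      ≈⟨ zeroˡ _ ⟩
    0#                   ∎)
    where instance _ = ℚ.≢-nonZero q≢0

  ι-injective : ∀ p q → ι p ≈ ι q → p ≡ q
  ι-injective p q ιp≈ιq with p ℚP.≟ q
  ... | yes p≡q = p≡q
  ... | no p≢q  = ⊥-elim (ι-nonzero (p ℚ.- q) (p≢q ∘ p-q≡0⇒p≡q p q) (begin
    ι (p ℚ.- q)      ≈⟨ ι-+ p (ℚ.- q) ⟩
    ι p + ι (ℚ.- q)  ≈⟨ +-cong ιp≈ιq (ι-neg q) ⟩
    ι q - ι q        ≈⟨ -‿inverseʳ (ι q) ⟩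
    0#               ∎))
    where open GroupProperties ℚP.+-0-group using () renaming (x∙y⁻¹≈ε⇒x≈y to p-q≡0⇒p≡q)

  nonzero-cancelʳ : ∀ {x y} → y ≉ 0# → x * y ≈ 0# → x ≈ 0#
  nonzero-cancelʳ {x} {y} y≉0 xy≈0 with inverse y y≉0
  ... | y⁻¹ , yy⁻¹≈1 = begin
    x                ≈⟨ *-identityʳ x ⟨
    x * 1#           ≈⟨ *-congˡ yy⁻¹≈1 ⟨
    x * (y * y⁻¹)    ≈⟨ *-assoc x y y⁻¹ ⟨
    (x * y) * y⁻¹    ≈⟨ *-congʳ xy≈0 ⟩
    0# * y⁻¹         ≈⟨ zeroˡ y⁻¹ ⟩
    0#               ∎

  nonzero-cancelˡ : ∀ {x y} → x ≉ 0# → x * y ≈ 0# → y ≈ 0#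
  nonzero-cancelˡ x≉0 xy≈0 = nonzero-cancelʳ x≉0 (trans (*-comm _ _) xy≈0)

  *-nonzero : ∀ {x y} → x ≉ 0# → y ≉ 0# → x * y ≉ 0#
  *-nonzero {x} {y} x≉0 y≉0 xy≈0 = x≉0 (nonzero-cancelʳ y≉0 xy≈0)

  pow-nonzero : ∀ {x} n → x ≉ 0# → pow F x n ≉ 0#
  pow-nonzero zero    x≉0 = nontrivial
  pow-nonzero (suc n) x≉0 = *-nonzero x≉0 (pow-nonzero n x≉0)

  ι-×ℚ : ∀ n → ι (n ×ℚ ℚ.1ℚ) ≈ n ×ᴿ 1#
  ι-×ℚ zero    = ι-0
  ι-×ℚ (suc n) = trans (ι-+ ℚ.1ℚ (n ×ℚ ℚ.1ℚ)) (+-cong ι-1 (ι-×ℚ n))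

  ×ℚ-positive : ∀ n → 0ℚ ℚ.< suc n ×ℚ ℚ.1ℚ
  ×ℚ-positive zero    = ℚ.*<* (ℤ.+<+ (s≤s z≤n))
  ×ℚ-positive (suc n) = ℚP.+-mono-< (×ℚ-positive zero) (×ℚ-positive n)

  characteristic-zero : ∀ n → suc n ×ᴿ 1# ≉ 0#
  characteristic-zero n n+1≈0 =
    ι-nonzero _ (ℚP.<⇒≢ (×ℚ-positive n) ∘ ≡.sym) (trans (ι-×ℚ (suc n)) n+1≈0)

  Fn : Set c
  Fn = Carrier → Carrier

  data Deg< : ℕ → Fn → Set (c ⊔ ℓ) where
    vanishing : ∀ {k f} → (∀ z → f z ≈ 0#) → Deg< k f
    split     : ∀ {k f} a {g} → Deg< k g → (∀ z → f z ≈ a + z * g z) → Deg< (suc k) f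

  deg<-resp : ∀ {k f g} → (∀ z → g z ≈ f z) → Deg< k f → Deg< k g
  deg<-resp g≈f (vanishing f≈0)  = vanishing λ z → trans (g≈f z) (f≈0 z)
  deg<-resp g≈f (split a pf f≈) = split a pf λ z → trans (g≈f z) (f≈ z)

  deg<-mono : ∀ {k k′ f} → k ≤ k′ → Deg< k f → Deg< k′ f
  deg<-mono k≤k′        (vanishing f≈0)  = vanishing f≈0
  deg<-mono (s≤s k≤k′)  (split a pf f≈) = split a (deg<-mono k≤k′ pf) f≈

  deg<0-vanishing : ∀ {f} → Deg< 0 f → ∀ z → f z ≈ 0#
  deg<0-vanishing (vanishing f≈0) = f≈0

  deg<-const : ∀ a → Deg< 1 (λ _ → a)
  deg<-const a = split a (vanishing λ _ → refl) λ z → sym (trans (+-congˡ (zeroʳ z)) (+-identityʳ a))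

  deg<-x* : ∀ {k f} → Deg< k f → Deg< (suc k) (λ z → z * f z)
  deg<-x* pf = split 0# pf λ z → sym (+-identityˡ _)

  deg<-+ : ∀ {k f g} → Deg< k f → Deg< k g → Deg< k (λ z → f z + g z)
  deg<-+ (vanishing f≈0) pg = deg<-resp (λ z → trans (+-congʳ (f≈0 z)) (+-identityˡ _)) pg
  deg<-+ pf (vanishing g≈0) = deg<-resp (λ z → trans (+-congˡ (g≈0 z)) (+-identityʳ _)) pf
  deg<-+ (split a {f′} pf f≈) (split b {g′} pg g≈) = split (a + b) (deg<-+ pf pg) λ z → begin
    _ + _                              ≈⟨ +-cong (f≈ z) (g≈ z) ⟩
    (a + z * f′ z) + (b + z * g′ z)    ≈⟨ solve 5 (λ a b z x y → (a :+ z :* x) :+ (b :+ z :* y) := (a :+ b) :+ z :* (x :+ y)) refl a b z (f′ z) (g′ z) ⟩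
    (a + b) + z * (f′ z + g′ z)        ∎

  deg<-scale : ∀ {k f} a → Deg< k f → Deg< k (λ z → a * f z)
  deg<-scale a (vanishing f≈0) = vanishing λ z → trans (*-congˡ (f≈0 z)) (zeroʳ a)
  deg<-scale a (split b {g} pg f≈) = split (a * b) (deg<-scale a pg) λ z → begin
    a * _                  ≈⟨ *-congˡ (f≈ z) ⟩
    a * (b + z * g z)      ≈⟨ solve 4 (λ a b z y → a :* (b :+ z :* y) := a :* b :+ z :* (a :* y)) refl a b z (g z) ⟩
    a * b + z * (a * g z)  ∎

  deg<-neg : ∀ {k f} → Deg< k f → Deg< k (λ z → - f z)
  deg<-neg pf = deg<-resp (λ z → sym (-1*x≈-x _)) (deg<-scale (- 1#) pf)

  deg<-− : ∀ {k f g} → Deg< k f → Deg< k g → Deg< k (λ z → f z - g z)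
  deg<-− pf pg = deg<-+ pf (deg<-neg pg)

  deg<-* : ∀ {a b f g} → Deg< (suc a) f → Deg< b g → Deg< (a ℕ.+ b) (λ z → f z * g z)
  deg<-* (vanishing f≈0) pg = vanishing λ z → trans (*-congʳ (f≈0 z)) (zeroˡ _)
  deg<-* {zero} {f = f} {g} (split c pf′ f≈) pg = deg<-resp fg≈cg (deg<-scale c pg)
    where
    fg≈cg : ∀ z → f z * g z ≈ c * g z
    fg≈cg z = trans (*-congʳ (trans (f≈ z) (+-congˡ (trans (*-congˡ (deg<0-vanishing pf′ z)) (zeroʳ z)))))
                    (*-congʳ (+-identityʳ c))
  deg<-* {suc a} {b} {f} {g} (split c {f′} pf′ f≈) pg =
    deg<-resp fg≈ (deg<-+ (deg<-mono (ℕP.m≤n+m b (suc a)) (deg<-scale c pg)) (deg<-x* (deg<-* pf′ pg)))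
    where
    fg≈ : ∀ z → f z * g z ≈ c * g z + z * (f′ z * g z)
    fg≈ z = trans (*-congʳ (f≈ z))
                  (solve 4 (λ c z x y → (c :+ z :* x) :* y := c :* y :+ z :* (x :* y)) refl c z (f′ z) (g z))

  deg<-pow : ∀ k → Deg< (suc k) (λ z → pow F z k)
  deg<-pow zero    = deg<-const 1#
  deg<-pow (suc k) = deg<-x* (deg<-pow k)

  deg<-∘ : ∀ {a b r g} → Deg< (suc a) r → Deg< (suc b) g → Deg< (suc (a ℕ.* b)) (λ z → r (g z))
  deg<-∘ (vanishing r≈0) pg = vanishing λ z → r≈0 _
  deg<-∘ {zero} {r = r} {g} (split c pr′ r≈) pg = deg<-resp r∘g≈c (deg<-const c)
    where
    r∘g≈c : ∀ z → r (g z) ≈ c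
    r∘g≈c z = trans (r≈ (g z)) (trans (+-congˡ (trans (*-congˡ (deg<0-vanishing pr′ _)) (zeroʳ _))) (+-identityʳ c))
  deg<-∘ {suc a} {b} {g = g} (split c pr′ r≈) pg =
    deg<-resp (λ z → r≈ (g z))
      (deg<-+ (deg<-mono (s≤s z≤n) (deg<-const c))
              (deg<-mono (ℕP.≤-reflexive (ℕP.+-suc b (a ℕ.* b))) (deg<-* pg (deg<-∘ pr′ pg))))

  Δ : Carrier → Fn → Fn
  Δ h f z = f (z + h) - f z

  deg<-shift : ∀ {k f} h → Deg< k f → Deg< k (λ z → f (z + h))
  deg<-shift h (vanishing f≈0) = vanishing λ z → f≈0 (z + h)
  deg<-shift {suc k} h pf@(split _ _ _) =
    deg<-mono (ℕP.≤-reflexive (≡.cong suc (ℕP.*-identityʳ k))) (deg<-∘ pf deg<-z+h)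
    where
    deg<-z+h : Deg< 2 (λ z → z + h)
    deg<-z+h = split h (deg<-const 1#) λ z → trans (+-comm z h) (+-congˡ (sym (*-identityʳ z)))

  deg<-Δ : ∀ {k f} h → Deg< (suc k) f → Deg< k (Δ h f)
  deg<-Δ h (vanishing f≈0) = vanishing λ z → trans (+-cong (f≈0 (z + h)) (-‿cong (f≈0 z))) (-‿inverseʳ 0#)
  deg<-Δ {zero} {f} h (split a pg f≈) = vanishing λ z → trans (+-cong (f≈a (z + h)) (-‿cong (f≈a z))) (-‿inverseʳ a)
    where
    f≈a : ∀ z → f z ≈ a
    f≈a z = trans (f≈ z) (trans (+-congˡ (trans (*-congˡ (deg<0-vanishing pg z)) (zeroʳ z))) (+-identityʳ a))
  deg<-Δ {suc k} {f} h (split a {g} pg f≈) =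
    deg<-resp Δf≈ (deg<-+ (deg<-x* (deg<-Δ h pg)) (deg<-scale h (deg<-shift h pg)))
    where
    Δf≈ : ∀ z → Δ h f z ≈ z * Δ h g z + h * g (z + h)
    Δf≈ z = trans (+-cong (f≈ (z + h)) (-‿cong (f≈ z)))
      (solve 5 (λ a z h x y → (a :+ (z :+ h) :* x) :- (a :+ z :* y) := z :* (x :- y) :+ h :* x) refl a z h (g (z + h)) (g z))

  Δ-pow : ∀ h k → Deg< k (λ z → Δ h (λ x → pow F x (suc k)) z - (suc k ×ᴿ h) * pow F z k)
  Δ-pow h zero = vanishing λ z → begin
    (z + h) * 1# - z * 1# - (h + 0#) * 1#
      ≈⟨ solve 4 (λ z h o n → (z :+ h) :* o :- z :* o :- (h :+ n) :* o := :- (n :* o)) refl z h 1# 0# ⟩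
    - (0# * 1#)  ≈⟨ -‿cong (zeroˡ 1#) ⟩
    - 0#         ≈⟨ -0#≈0# ⟩
    0#           ∎
  Δ-pow h (suc k) = deg<-resp Δzᵏ⁺²≈
    (deg<-+ (deg<-+ (deg<-x* (Δ-pow h k)) (deg<-mono (ℕP.n≤1+n k) (deg<-scale h (Δ-pow h k))))
            (deg<-scale (h * (suc k ×ᴿ h)) (deg<-pow k)))
    where
    E : Fn
    E z = Δ h (λ x → pow F x (suc k)) z - (suc k ×ᴿ h) * pow F z k
    Δzᵏ⁺²≈ : ∀ z → Δ h (λ x → pow F x (suc (suc k))) z - (suc (suc k) ×ᴿ h) * pow F z (suc k)
                   ≈ (z * E z + h * E z) + (h * (suc k ×ᴿ h)) * pow F z k
    Δzᵏ⁺²≈ z = solve 5 (λ z h A P e →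
        (z :+ h) :* A :- z :* (z :* P) :- (h :+ e) :* (z :* P)
      := (z :* (A :- z :* P :- e :* P) :+ h :* (A :- z :* P :- e :* P)) :+ (h :* e) :* P)
      refl z h (pow F (z + h) (suc k)) (pow F z k) (suc k ×ᴿ h)

  -- Δ 1# lowers the degree and multiplies the leading coefficient by k + 1, which is nonzero.
  leading-coefficient-zero : ∀ k c {r} → Deg< k r → (∀ z → c * pow F z k + r z ≈ 0#) → c ≈ 0#
  leading-coefficient-zero zero c pr eq = begin
    c                 ≈⟨ *-identityʳ c ⟨
    c * 1#            ≈⟨ +-identityʳ _ ⟨
    c * 1# + 0#       ≈⟨ +-congˡ (deg<0-vanishing pr 0#) ⟨
    c * 1# + _        ≈⟨ eq 0# ⟩
    0#                ∎
  leading-coefficient-zero (suc k) c {r} pr eq = nonzero-cancelʳ (characteristic-zero k)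
    (leading-coefficient-zero k (c * e) (deg<-+ (deg<-scale c (Δ-pow 1# k)) (deg<-Δ 1# pr)) Δeq)
    where
    e : Carrier
    e = suc k ×ᴿ 1#
    Δeq : ∀ z → c * e * pow F z k + (c * (Δ 1# (λ x → pow F x (suc k)) z - e * pow F z k) + Δ 1# r z) ≈ 0#
    Δeq z = begin
      _  ≈⟨ solve 7 (λ c e P Y W a b → c :* e :* P :+ (c :* ((Y :- W) :- e :* P) :+ (a :- b))
                                  := (c :* Y :+ a) :- (c :* W :+ b))
                    refl c e (pow F z k) (pow F (z + 1#) (suc k)) (pow F z (suc k)) (r (z + 1#)) (r z) ⟩
      _  ≈⟨ +-cong (eq (z + 1#)) (-‿cong (eq z)) ⟩
      0# - 0#  ≈⟨ -‿inverseʳ 0# ⟩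
      0#       ∎

  pow-+ : ∀ z m n → pow F z (m ℕ.+ n) ≈ pow F z m * pow F z n
  pow-+ z zero    n = sym (*-identityˡ _)
  pow-+ z (suc m) n = trans (*-congˡ (pow-+ z m n)) (sym (*-assoc z _ _))

  ×-zeroʳ : ∀ n → n ×ᴿ 0# ≈ 0#
  ×-zeroʳ n = begin
    n ×ᴿ 0#          ≈⟨ ×-congʳ n (zeroˡ 0#) ⟨
    n ×ᴿ (0# * 0#)   ≈⟨ ×-comm-* n 0# 0# ⟨
    0# * (n ×ᴿ 0#)   ≈⟨ zeroˡ _ ⟩
    0#               ∎

  -- The index k is one less than the degree.
  record LeadingTerms (k : ℕ) (L S : Carrier) (f : Fn) : Set (c ⊔ ℓ) where
    constructor leadingTerms
    field
      lower     : Fn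
      lower-deg : Deg< k lower
      expand    : ∀ z → f z ≈ L * pow F z (suc k) + S * pow F z k + lower z

  leadingTerms-resp : ∀ {k L S f g} → (∀ z → g z ≈ f z) → LeadingTerms k L S f → LeadingTerms k L S g
  leadingTerms-resp g≈f (leadingTerms r pr f≈) = leadingTerms r pr λ z → trans (g≈f z) (f≈ z)

  leadingTerms-cong : ∀ {k L L′ S S′ f} → L ≈ L′ → S ≈ S′ → LeadingTerms k L S f → LeadingTerms k L′ S′ f
  leadingTerms-cong L≈L′ S≈S′ (leadingTerms r pr f≈) =
    leadingTerms r pr λ z → trans (f≈ z) (+-congʳ (+-cong (*-congʳ L≈L′) (*-congʳ S≈S′)))

  leadingTerms⇒deg< : ∀ {k L S f} → LeadingTerms k L S f → Deg< (suc (suc k)) f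
  leadingTerms⇒deg< {k} {L} {S} (leadingTerms r pr f≈) = deg<-resp f≈
    (deg<-+ (deg<-+ (deg<-scale L (deg<-pow (suc k))) (deg<-mono (ℕP.n≤1+n _) (deg<-scale S (deg<-pow k))))
            (deg<-mono (ℕP.m≤n+m k 2) pr))

  leadingTerms-+lower : ∀ {k L S f h} → LeadingTerms k L S f → Deg< k h → LeadingTerms k L S (λ z → f z + h z)
  leadingTerms-+lower (leadingTerms r pr f≈) ph =
    leadingTerms _ (deg<-+ pr ph) λ z → trans (+-congʳ (f≈ z)) (+-assoc _ _ _)

  leadingTerms-scale : ∀ {k L S f} a → LeadingTerms k L S f → LeadingTerms k (a * L) (a * S) (λ z → a * f z)
  leadingTerms-scale {k} {L} {S} a (leadingTerms r pr f≈) = leadingTerms _ (deg<-scale a pr) λ z →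
    trans (*-congˡ (f≈ z)) (solve 6 (λ a L S X Y r → a :* (L :* X :+ S :* Y :+ r) := a :* L :* X :+ a :* S :* Y :+ a :* r)
                                    refl a L S (pow F z (suc k)) (pow F z k) (r z))

  leadingTerms-affine : ∀ a b → LeadingTerms 0 a b (λ z → a * z + b)
  leadingTerms-affine a b = leadingTerms _ (vanishing λ _ → refl) λ z →
    sym (trans (+-identityʳ _) (+-cong (*-congˡ (*-identityʳ z)) (*-identityʳ b)))

  leadingTerms-* : ∀ {a b L S M T f g} → LeadingTerms a L S f → LeadingTerms b M T g →
                   LeadingTerms (suc (a ℕ.+ b)) (L * M) (L * T + S * M) (λ z → f z * g z)
  leadingTerms-* {a} {b} {L} {S} {M} {T} {f} {g} (leadingTerms r pr f≈) (leadingTerms s ps g≈) =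
    leadingTerms lower lower-deg λ z → begin
      f z * g z
        ≈⟨ *-cong (f≈ z) (g≈ z) ⟩
      (L * (z * zᵃ z) + S * zᵃ z + r z) * (M * (z * zᵇ z) + T * zᵇ z + s z)
        ≈⟨ solve 9 (λ L S M T z Y V r s →
             (L :* (z :* Y) :+ S :* Y :+ r) :* (M :* (z :* V) :+ T :* V :+ s) :=
             L :* M :* (z :* (z :* (Y :* V))) :+ (L :* T :+ S :* M) :* (z :* (Y :* V)) :+
             (S :* T :* (Y :* V) :+ L :* (z :* (Y :* s)) :+ S :* (Y :* s) :+ M :* (z :* (V :* r)) :+ T :* (V :* r) :+ r :* s))
             refl L S M T z (zᵃ z) (zᵇ z) (r z) (s z) ⟩
      L * M * (z * (z * (zᵃ z * zᵇ z))) + (L * T + S * M) * (z * (zᵃ z * zᵇ z)) + _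
        ≈⟨ +-congʳ (+-cong (*-congˡ (*-congˡ (*-congˡ (sym (pow-+ z a b))))) (*-congˡ (*-congˡ (sym (pow-+ z a b))))) ⟩
      L * M * pow F z (suc (suc (a ℕ.+ b))) + (L * T + S * M) * pow F z (suc (a ℕ.+ b)) + lower z ∎
    where
    zᵃ zᵇ : Fn
    zᵃ z = pow F z a
    zᵇ z = pow F z b
    lower : Fn
    lower z = S * T * (zᵃ z * zᵇ z) + L * (z * (zᵃ z * s z)) + S * (zᵃ z * s z)
              + M * (z * (zᵇ z * r z)) + T * (zᵇ z * r z) + r z * s z
    deg-zᵃs : Deg< (a ℕ.+ b) (λ z → zᵃ z * s z)
    deg-zᵃs = deg<-* (deg<-pow a) ps
    deg-zᵇr : Deg< (a ℕ.+ b) (λ z → zᵇ z * r z)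
    deg-zᵇr = deg<-mono (ℕP.≤-reflexive (ℕP.+-comm b a)) (deg<-* (deg<-pow b) pr)
    lower-deg : Deg< (suc (a ℕ.+ b)) lower
    lower-deg =
      deg<-+ (deg<-+ (deg<-+ (deg<-+ (deg<-+ (deg<-scale (S * T) (deg<-resp (λ z → sym (pow-+ z a b)) (deg<-pow (a ℕ.+ b))))
                                             (deg<-scale L (deg<-x* deg-zᵃs)))
                                     (deg<-mono (ℕP.n≤1+n _) (deg<-scale S deg-zᵃs)))
                             (deg<-scale M (deg<-x* deg-zᵇr)))
                     (deg<-mono (ℕP.n≤1+n _) (deg<-scale T deg-zᵇr)))
             (deg<-mono (ℕP.n≤1+n _) (deg<-* (deg<-mono (ℕP.n≤1+n a) pr) ps))

  -- If g has index k, then g^(n+1) has index (n + 1)(k + 1) - 1.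
  powIndex : ℕ → ℕ → ℕ
  powIndex k zero    = k
  powIndex k (suc n) = suc (k ℕ.+ powIndex k n)

  powIndex-≥ : ∀ k n → n ℕ.* suc k ≤ powIndex k n
  powIndex-≥ k zero    = z≤n
  powIndex-≥ k (suc n) = s≤s (ℕP.+-monoʳ-≤ k (powIndex-≥ k n))

  powIndex-≥-base : ∀ k n → k ≤ powIndex k n
  powIndex-≥-base k zero    = ℕP.≤-refl
  powIndex-≥-base k (suc n) = ℕP.≤-trans (ℕP.m≤m+n k _) (ℕP.n≤1+n _)

  powIndex-linear : ∀ n → powIndex 0 n ≡ n
  powIndex-linear zero    = ≡.refl
  powIndex-linear (suc n) = ≡.cong suc (powIndex-linear n)

  leadingTerms-pow : ∀ {k M T g} n → LeadingTerms k M T g →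
                     LeadingTerms (powIndex k n) (pow F M (suc n)) (suc n ×ᴿ (pow F M n * T)) (λ z → pow F (g z) (suc n))
  leadingTerms-pow {M = M} {T} zero shg =
    leadingTerms-resp (λ z → *-identityʳ _)
      (leadingTerms-cong (sym (*-identityʳ M)) (sym (trans (×-homo-1 (1# * T)) (*-identityˡ T))) shg)
  leadingTerms-pow {M = M} {T} (suc n) shg = leadingTerms-cong refl subleading (leadingTerms-* shg (leadingTerms-pow n shg))
    where
    subleading : M * (suc n ×ᴿ (pow F M n * T)) + T * (M * pow F M n) ≈ suc (suc n) ×ᴿ ((M * pow F M n) * T)
    subleading = begin
      M * (suc n ×ᴿ (pow F M n * T)) + T * (M * pow F M n)  ≈⟨ +-comm _ _ ⟩
      T * (M * pow F M n) + M * (suc n ×ᴿ (pow F M n * T))  ≈⟨ +-cong (*-comm T _) (×-comm-* (suc n) M _) ⟩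
      (M * pow F M n) * T + suc n ×ᴿ (M * (pow F M n * T))  ≈⟨ +-congˡ (×-congʳ (suc n) (sym (*-assoc M _ T))) ⟩
      suc (suc n) ×ᴿ ((M * pow F M n) * T)                  ∎

  leading-coefficient-zero-below : ∀ {b M T f} → LeadingTerms b M T f → Deg< (suc b) f → M ≈ 0#
  leading-coefficient-zero-below {b} {M} {T} {f} (leadingTerms s ps f≈) pf =
    leading-coefficient-zero (suc b) M (deg<-− (deg<-+ (deg<-scale T (deg<-pow b)) (deg<-mono (ℕP.n≤1+n b) ps)) pf)
      λ z → begin
        M * pow F z (suc b) + ((T * pow F z b + s z) - f z)  ≈⟨ +-congˡ (+-congˡ (-‿cong (f≈ z))) ⟩
        M * pow F z (suc b) + ((T * pow F z b + s z) - (M * pow F z (suc b) + T * pow F z b + s z))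
          ≈⟨ solve 5 (λ M X T Y s → M :* X :+ ((T :* Y :+ s) :- (M :* X :+ T :* Y :+ s))
                                   := (M :* X :+ T :* Y :+ s) :- (M :* X :+ T :* Y :+ s))
                     refl M (pow F z (suc b)) T (pow F z b) (s z) ⟩
        _ - _                                                  ≈⟨ -‿inverseʳ _ ⟩
        0#                                                     ∎

  leadingTerms-unique : ∀ {a b L S M T f} → LeadingTerms a L S f → LeadingTerms b M T f →
                        L ≉ 0# → M ≉ 0# → a ≡ b × S ≈ T
  leadingTerms-unique {a} {b} shf shg L≉0 M≉0 with ℕP.<-cmp a b
  ... | tri< a<b _ _ = ⊥-elim (M≉0 (leading-coefficient-zero-below shg (deg<-mono (s≤s a<b) (leadingTerms⇒deg< shf))))
  ... | tri> _ _ b<a = ⊥-elim (L≉0 (leading-coefficient-zero-below shf (deg<-mono (s≤s b<a) (leadingTerms⇒deg< shg))))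
  leadingTerms-unique {a} {L = L} {S} {M} {T} {f} (leadingTerms r pr f≈) (leadingTerms s ps f≈′) _ _ | tri≈ _ ≡.refl _ =
    ≡.refl , x∙y⁻¹≈ε⇒x≈y S T (leading-coefficient-zero a (S - T) (deg<-− pr ps) lower-diff≈0)
    where
    diff≈0 : ∀ z → (L - M) * pow F z (suc a) + ((S - T) * pow F z a + (r z - s z)) ≈ 0#
    diff≈0 z = begin
      _  ≈⟨ solve 8 (λ L M S T X Y r s → (L :- M) :* X :+ ((S :- T) :* Y :+ (r :- s))
                                        := (L :* X :+ S :* Y :+ r) :- (M :* X :+ T :* Y :+ s))
                    refl L M S T (pow F z (suc a)) (pow F z a) (r z) (s z) ⟩
      _  ≈⟨ +-cong (f≈ z) (-‿cong (f≈′ z)) ⟨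
      f z - f z  ≈⟨ -‿inverseʳ (f z) ⟩
      0#         ∎
    L≈M : L - M ≈ 0#
    L≈M = leading-coefficient-zero (suc a) (L - M)
            (deg<-+ (deg<-scale (S - T) (deg<-pow a)) (deg<-mono (ℕP.n≤1+n a) (deg<-− pr ps)))
            diff≈0
    lower-diff≈0 : ∀ z → (S - T) * pow F z a + (r z - s z) ≈ 0#
    lower-diff≈0 z = trans (sym (trans (+-congʳ (trans (*-congʳ L≈M) (zeroˡ _))) (+-identityˡ _))) (diff≈0 z)

  deg<-∘-leadingTerms : ∀ {N k M T r g} → Deg< N r → LeadingTerms k M T g → Deg< (powIndex k N) (λ z → r (g z))
  deg<-∘-leadingTerms {zero} pr _ = vanishing λ z → deg<0-vanishing pr _
  deg<-∘-leadingTerms {suc N} {k} pr shg =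
    deg<-mono (s≤s (ℕP.≤-trans (powIndex-≥ k N) (ℕP.m≤n+m _ k))) (deg<-∘ pr (leadingTerms⇒deg< shg))

  leadingTerms-∘ : ∀ {N L f k M T g} → LeadingTerms N L 0# f → LeadingTerms k M T g →
                   LeadingTerms (powIndex k N) (L * pow F M (suc N)) (L * (suc N ×ᴿ (pow F M N * T))) (λ z → f (g z))
  leadingTerms-∘ {N} {L} {g = g} (leadingTerms r pr f≈) shg =
    leadingTerms-resp (λ z → trans (f≈ (g z)) (+-assoc _ _ _))
      (leadingTerms-+lower (leadingTerms-scale L (leadingTerms-pow N shg))
        (deg<-resp (λ z → trans (+-congʳ (zeroˡ _)) (+-identityˡ _)) (deg<-∘-leadingTerms pr shg)))

  -- The shape of ψ_a, whose coefficient a_{d-1} vanishes.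
  record Depressed (f : Fn) : Set (c ⊔ ℓ) where
    field
      index        : ℕ
      1≤index      : 1 ≤ index
      leading      : Carrier
      leading≉0    : leading ≉ 0#
      terms        : LeadingTerms index leading 0# f

  depressed-∘ : ∀ {f g} → Depressed f → Depressed g → Depressed (λ z → f (g z))
  depressed-∘ Df Dg = record
    { index        = powIndex N k
    ; 1≤index      = ℕP.≤-trans (Depressed.1≤index Dg) (powIndex-≥-base N k)
    ; leading      = L * pow F M (suc k)
    ; leading≉0    = *-nonzero (Depressed.leading≉0 Df) (pow-nonzero (suc k) (Depressed.leading≉0 Dg))
    ; terms        = leadingTerms-cong refl subleading≈0
                       (leadingTerms-∘ (Depressed.terms Df) (Depressed.terms Dg))
    }
    where
    open Depressed Df using () renaming (index to k; leading to L)
    open Depressed Dg using () renaming (index to N; leading to M)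
    subleading≈0 : L * (suc k ×ᴿ (pow F M k * 0#)) ≈ 0#
    subleading≈0 = trans (*-congˡ (trans (×-congʳ (suc k) (zeroʳ _)) (×-zeroʳ (suc k)))) (zeroʳ L)

  iterate-depressed : ∀ {f} n → Depressed f → Depressed (iter (suc n) f)
  iterate-depressed zero    Df = Df
  iterate-depressed (suc n) Df = depressed-∘ Df (iterate-depressed n Df)

  -- The subleading coefficient of f (α z + β) is L (N + 1) α^N β; that of α g z + β vanishes,
  -- unless g is linear, and then the degrees already differ.
  conjugacy-translation≈0 : ∀ {f g k e α β} → Depressed f → LeadingTerms k e 0# g → e ≉ 0# → α ≉ 0# →
                            (∀ z → α * g z + β ≈ f (α * z + β)) → β ≈ 0#
  conjugacy-translation≈0 {f} {g} {e = e} {α} {β} Df shg e≉0 α≉0 conj = translation≈0 shg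
    where
    open Depressed Df using (1≤index; leading≉0) renaming (index to N; leading to L)
    lhs : LeadingTerms N (L * pow F α (suc N)) (L * (suc N ×ᴿ (pow F α N * β))) (λ z → α * g z + β)
    lhs = leadingTerms-resp conj
            (≡.subst (λ i → LeadingTerms i (L * pow F α (suc N)) (L * (suc N ×ᴿ (pow F α N * β))) (λ z → f (α * z + β)))
                     (powIndex-linear N)
              (leadingTerms-∘ (Depressed.terms Df) (leadingTerms-affine α β)))
    lhs-leading≉0 : L * pow F α (suc N) ≉ 0#
    lhs-leading≉0 = *-nonzero leading≉0 (pow-nonzero (suc N) α≉0)
    deg<-β : ∀ {i} → Deg< (suc i) (λ _ → β)
    deg<-β = deg<-mono (s≤s z≤n) (deg<-const β)
    translation≈0 : ∀ {i} → LeadingTerms i e 0# g → β ≈ 0#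
    translation≈0 {zero} sh = ⊥-elim (lhs-leading≉0 (leading-coefficient-zero-below lhs
      (deg<-mono (s≤s 1≤index) (deg<-+ (deg<-scale α (leadingTerms⇒deg< sh)) deg<-β))))
    translation≈0 {suc _} sh =
      nonzero-cancelˡ (pow-nonzero N α≉0) (nonzero-cancelˡ (characteristic-zero N) (begin
        (suc N ×ᴿ 1#) * (pow F α N * β)  ≈⟨ ×-assoc-* (suc N) 1# _ ⟩
        suc N ×ᴿ (1# * (pow F α N * β))  ≈⟨ ×-congʳ (suc N) (*-identityˡ _) ⟩
        suc N ×ᴿ (pow F α N * β)         ≈⟨ nonzero-cancelˡ leading≉0 (trans (sym α0≈subleading) (zeroʳ α)) ⟩
        0#                               ∎))
      where
      α0≈subleading : α * 0# ≈ L * (suc N ×ᴿ (pow F α N * β))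
      α0≈subleading = proj₂ (leadingTerms-unique (leadingTerms-+lower (leadingTerms-scale α sh) deg<-β) lhs
                                                 (*-nonzero α≉0 e≉0) lhs-leading≉0)

  conjugate⇒semiconjugate : ∀ {f g k e} → Depressed f → LeadingTerms k e 0# g → e ≉ 0# → Congruent₁ f →
                            Conjugate F f g → ∃[ α ] (∀ w → f (α * w) ≈ α * g w)
  conjugate⇒semiconjugate {f} {g} Df shg e≉0 f-cong (α , β , α≉0 , conj) = α , λ w → begin
    f (α * w)      ≈⟨ f-cong (+-αw≈αw w) ⟨
    f (α * w + β)  ≈⟨ conj w ⟨
    α * g w + β    ≈⟨ +-αw≈αw (g w) ⟩
    α * g w        ∎
    where
    +-αw≈αw : ∀ w → α * w + β ≈ α * w
    +-αw≈αw w = trans (+-congˡ (conjugacy-translation≈0 Df shg e≉0 α≉0 conj)) (+-identityʳ _)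

  leadingTerms-x*+ : ∀ {k L S h} a → LeadingTerms k L S h → LeadingTerms (suc k) L S (λ z → a + z * h z)
  leadingTerms-x*+ {k} {L} {S} a (leadingTerms r pr h≈) =
    leadingTerms _ (deg<-+ (deg<-mono (s≤s z≤n) (deg<-const a)) (deg<-x* pr)) λ z →
      trans (+-congˡ (*-congˡ (h≈ z)))
        (solve 6 (λ a L S z Q r → a :+ z :* (L :* (z :* Q) :+ S :* Q :+ r) := L :* (z :* (z :* Q)) :+ S :* (z :* Q) :+ (a :+ z :* r))
               refl a L S z (pow F z k) (r z))

  leadingTerms-horner : ∀ k (φ : Fin (suc (suc k)) → Carrier) →
    LeadingTerms k (φ (Fin.fromℕ (suc k))) (φ (Fin.inject₁ (Fin.fromℕ k))) (horner F (List.tabulate φ))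
  leadingTerms-horner zero φ = leadingTerms-resp affine≈ (leadingTerms-affine (φ (Fin.suc Fin.zero)) (φ Fin.zero))
    where
    affine≈ : ∀ z → φ Fin.zero + z * (φ (Fin.suc Fin.zero) + z * 0#) ≈ φ (Fin.suc Fin.zero) * z + φ Fin.zero
    affine≈ z = trans (+-comm _ _) (+-congʳ (trans (*-congˡ (trans (+-congˡ (zeroʳ z)) (+-identityʳ _))) (*-comm z _)))
  leadingTerms-horner (suc k) φ = leadingTerms-x*+ (φ Fin.zero) (leadingTerms-horner k (φ ∘ Fin.suc))

  ψK≡horner : ∀ d a → ψK K d a ≡ horner F (List.tabulate (λ i → ι (ratio (a i) (a Fin.zero))))
  ψK≡horner d a = ≡.cong (horner F) (≡.trans
    (≡.cong (List.map ι) (ListP.map-tabulate (λ i → i) (λ i → ratio (a i) (a Fin.zero))))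
    (ListP.map-tabulate (λ i → ratio (a i) (a Fin.zero)) ι))

  ψ-depressed : ∀ {d a} → 2 ≤ d → InP d a → Depressed (ψK K d a)
  ψ-depressed {suc (suc k)} {a} (s≤s (s≤s z≤n)) a∈P = record
    { index        = suc k
    ; 1≤index      = s≤s z≤n
    ; leading      = coeff (Fin.fromℕ (suc (suc k)))
    ; leading≉0    = ι-nonzero _ (ratio-nonzero _ _ (constPos Fin.zero ≡.refl)
                                                    (leadingNZ _ (FinP.toℕ-fromℕ (suc (suc k)))))
    ; terms        = ≡.subst (LeadingTerms (suc k) _ 0#) (≡.sym (ψK≡horner (suc (suc k)) a))
                       (leadingTerms-cong refl subleading≈0 (leadingTerms-horner (suc k) coeff))
    }
    where
    open InP a∈P
    coeff : Fin (suc (suc (suc k))) → Carrier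
    coeff i = ι (ratio (a i) (a Fin.zero))
    subleading≈0 : coeff (Fin.inject₁ (Fin.fromℕ (suc k))) ≈ 0#
    subleading≈0 = trans (reflexive (≡.cong ι (≡.trans
      (≡.cong (λ x → ratio x (a Fin.zero))
              (noSubleading _ (≡.trans (FinP.toℕ-inject₁ (Fin.fromℕ (suc k))) (FinP.toℕ-fromℕ (suc k)))))
      (ratio-zero (a Fin.zero))))) ι-0

  leadingTerms-monomial : ∀ k → LeadingTerms k 1# 0# (λ z → pow F z (suc k))
  leadingTerms-monomial k = leadingTerms _ (vanishing λ _ → refl) λ z →
    sym (trans (+-identityʳ _) (trans (+-cong (*-identityˡ _) (zeroˡ _)) (+-identityʳ _)))

  two : Carrier
  two = 1# + 1#

  leadingTerms-cheb : ∀ k → LeadingTerms k 1# 0# (cheb F (suc k))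
  leadingTerms-cheb zero = leadingTerms-resp (λ z → sym (trans (+-identityʳ _) (*-identityˡ z))) (leadingTerms-affine 1# 0#)
  leadingTerms-cheb (suc zero) = leadingTerms-resp (λ z → +-comm _ _) (leadingTerms-x*+ (- two) (leadingTerms-cheb zero))
  leadingTerms-cheb (suc (suc k)) = leadingTerms-resp (λ z → +-congʳ (sym (+-identityˡ _)))
    (leadingTerms-+lower (leadingTerms-x*+ 0# (leadingTerms-cheb (suc k))) (deg<-neg (leadingTerms⇒deg< (leadingTerms-cheb k))))

  leadingTerms-neg-cheb : ∀ k → LeadingTerms k (- 1#) 0# (λ z → - cheb F (suc k) z)
  leadingTerms-neg-cheb k = leadingTerms-resp (λ z → sym (-1*x≈-x _))
    (leadingTerms-cong (*-identityʳ (- 1#)) (zeroʳ (- 1#)) (leadingTerms-scale (- 1#) (leadingTerms-cheb k)))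

  -1≉0 : - 1# ≉ 0#
  -1≉0 -1≈0 = nontrivial (trans (sym (-‿involutive 1#)) (trans (-‿cong -1≈0) -0#≈0#))

  cheb-cong : ∀ l → Congruent₁ (cheb F l)
  cheb-cong zero          x≈y = refl
  cheb-cong (suc zero)    x≈y = x≈y
  cheb-cong (suc (suc l)) x≈y = +-cong (*-cong x≈y (cheb-cong (suc l) x≈y)) (-‿cong (cheb-cong l x≈y))

  two*two-two≈two : two * two - two ≈ two
  two*two-two≈two = begin
    two * two - two              ≈⟨ +-congʳ (distribˡ two 1# 1#) ⟩
    (two * 1# + two * 1#) - two  ≈⟨ +-congʳ (+-cong (*-identityʳ two) (*-identityʳ two)) ⟩
    (two + two) - two            ≈⟨ +-assoc two two (- two) ⟩
    two + (two - two)            ≈⟨ +-congˡ (-‿inverseʳ two) ⟩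
    two + 0#                     ≈⟨ +-identityʳ two ⟩
    two                          ∎

  cheb-two : ∀ l → cheb F l two ≈ two
  cheb-two zero          = refl
  cheb-two (suc zero)    = refl
  cheb-two (suc (suc l)) = trans (+-cong (*-congˡ (cheb-two (suc l))) (-‿cong (cheb-two l))) two*two-two≈two

  cheb-0-step : ∀ l → cheb F (suc (suc l)) 0# ≈ - cheb F l 0#
  cheb-0-step l = trans (+-congʳ (zeroˡ _)) (+-identityˡ _)

  EvenValues OddValues : ℕ → Set ℓ
  EvenValues l = (cheb F l 0# ≈ two ⊎ cheb F l 0# ≈ - two) × cheb F l (- two) ≈ two
  OddValues  l = cheb F l 0# ≈ 0# × cheb F l (- two) ≈ - two

  cheb-−two-step⁺ : ∀ l → cheb F (suc l) (- two) ≈ - two → cheb F l (- two) ≈ two → cheb F (suc (suc l)) (- two) ≈ two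
  cheb-−two-step⁺ l C′≈-2 C≈2 = begin
    - two * cheb F (suc l) (- two) - cheb F l (- two)  ≈⟨ +-cong (*-congˡ C′≈-2) (-‿cong C≈2) ⟩
    - two * (- two) - two                              ≈⟨ solve 1 (λ t → :- t :* (:- t) :- t := t :* t :- t) refl two ⟩
    two * two - two                                    ≈⟨ two*two-two≈two ⟩
    two                                                ∎

  cheb-−two-step⁻ : ∀ l → cheb F (suc l) (- two) ≈ two → cheb F l (- two) ≈ - two → cheb F (suc (suc l)) (- two) ≈ - two
  cheb-−two-step⁻ l C′≈2 C≈-2 = begin
    - two * cheb F (suc l) (- two) - cheb F l (- two)  ≈⟨ +-cong (*-congˡ C′≈2) (-‿cong C≈-2) ⟩
    - two * two - (- two)                              ≈⟨ solve 1 (λ t → :- t :* t :- (:- t) := :- (t :* t :- t)) refl two ⟩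
    - (two * two - two)                                ≈⟨ -‿cong two*two-two≈two ⟩
    - two                                              ∎

  cheb-values : ∀ l → (EvenValues l × OddValues (suc l)) ⊎ (OddValues l × EvenValues (suc l))
  cheb-values zero = inj₁ ((inj₁ refl , refl) , (refl , refl))
  cheb-values (suc l) with cheb-values l
  ... | inj₁ ((C0≈±2 , C-2≈2) , odd@(_ , C′-2≈-2)) = inj₂ (odd , negate C0≈±2 , cheb-−two-step⁺ l C′-2≈-2 C-2≈2)
    where
    negate : cheb F l 0# ≈ two ⊎ cheb F l 0# ≈ - two → cheb F (suc (suc l)) 0# ≈ two ⊎ cheb F (suc (suc l)) 0# ≈ - two
    negate (inj₁ C0≈2)  = inj₂ (trans (cheb-0-step l) (-‿cong C0≈2))
    negate (inj₂ C0≈-2) = inj₁ (trans (cheb-0-step l) (trans (-‿cong C0≈-2) (-‿involutive two)))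
  ... | inj₂ ((C0≈0 , C-2≈-2) , even@(_ , C′-2≈2)) =
    inj₁ (even , trans (cheb-0-step l) (trans (-‿cong C0≈0) -0#≈0#) , cheb-−two-step⁻ l C′-2≈2 C-2≈-2)

  cheb-even-or-odd : ∀ l → EvenValues l ⊎ OddValues l
  cheb-even-or-odd l with cheb-values l
  ... | inj₁ (even , _) = inj₁ even
  ... | inj₂ (odd , _)  = inj₂ odd

  lands-on-fixed-point : ∀ {g x} → Congruent₁ g → g x ≈ x → g (g 0#) ≈ x → g (g (g 0#)) ≈ g (g 0#)
  lands-on-fixed-point g-cong gx≈x gg0≈x = trans (g-cong gg0≈x) (trans gx≈x (sym gg0≈x))

  fixes-0 : ∀ {g} → Congruent₁ g → g 0# ≈ 0# → g (g (g 0#)) ≈ g (g 0#)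
  fixes-0 g-cong g0≈0 = lands-on-fixed-point g-cong g0≈0 (trans (g-cong g0≈0) g0≈0)

  cheb-0-preperiodic : ∀ l → let C = cheb F l in C (C (C 0#)) ≈ C (C 0#)
  cheb-0-preperiodic l with cheb-even-or-odd l
  ... | inj₂ (C0≈0 , _)     = fixes-0 (cheb-cong l) C0≈0
  ... | inj₁ (C0≈±2 , C-2≈2) = lands-on-fixed-point (cheb-cong l) (cheb-two l) (CC0≈2 C0≈±2)
    where
    CC0≈2 : cheb F l 0# ≈ two ⊎ cheb F l 0# ≈ - two → cheb F l (cheb F l 0#) ≈ two
    CC0≈2 (inj₁ C0≈2)  = trans (cheb-cong l C0≈2) (cheb-two l)
    CC0≈2 (inj₂ C0≈-2) = trans (cheb-cong l C0≈-2) C-2≈2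

  neg-cheb-0-preperiodic : ∀ l → let C = λ z → - cheb F l z in C (C (C 0#)) ≈ C (C 0#)
  neg-cheb-0-preperiodic l with cheb-even-or-odd l
  ... | inj₂ (C0≈0 , _)     = fixes-0 (-‿cong ∘ cheb-cong l) (trans (-‿cong C0≈0) -0#≈0#)
  ... | inj₁ (C0≈±2 , C-2≈2) = lands-on-fixed-point (-‿cong ∘ cheb-cong l) (-‿cong C-2≈2) (CC0≈-2 C0≈±2)
    where
    CC0≈-2 : cheb F l 0# ≈ two ⊎ cheb F l 0# ≈ - two → - cheb F l (- cheb F l 0#) ≈ - two
    CC0≈-2 (inj₁ C0≈2)  = -‿cong (trans (cheb-cong l (-‿cong C0≈2)) C-2≈2)
    CC0≈-2 (inj₂ C0≈-2) = -‿cong (trans (cheb-cong l (trans (-‿cong C0≈-2) (-‿involutive two))) (cheb-two l))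

  pow-cong : ∀ m → Congruent₁ (λ z → pow F z m)
  pow-cong zero    x≈y = refl
  pow-cong (suc m) x≈y = *-cong x≈y (pow-cong m x≈y)

  monomial-0-preperiodic : ∀ k → let C = λ z → pow F z (suc k) in C (C (C 0#)) ≈ C (C 0#)
  monomial-0-preperiodic k = fixes-0 (pow-cong (suc k)) (zeroˡ _)

  horner-cong : ∀ cs → Congruent₁ (horner F cs)
  horner-cong []       x≈y = refl
  horner-cong (c ∷ cs) x≈y = +-congˡ (*-cong x≈y (horner-cong cs x≈y))

  ψK-cong : ∀ d a → Congruent₁ (ψK K d a)
  ψK-cong d a = horner-cong (List.map ι (coeffsℚ d a))

  iter-cong : ∀ {f} n → Congruent₁ f → Congruent₁ (iter n f)
  iter-cong zero    f-cong x≈y = x≈y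
  iter-cong (suc n) f-cong x≈y = f-cong (iter-cong n f-cong x≈y)

  ι-horner : ∀ cs q → ι (hornerℚ cs q) ≈ horner F (List.map ι cs) (ι q)
  ι-horner []       q = ι-0
  ι-horner (c ∷ cs) q = trans (ι-+ _ _) (+-congˡ (trans (ι-* _ _) (*-congˡ (ι-horner cs q))))

  ι-iter : ∀ d a n q → ι (iter n (ψℚ d a) q) ≈ iter n (ψK K d a) (ι q)
  ι-iter d a zero    q = refl
  ι-iter d a (suc n) q = trans (ι-horner (coeffsℚ d a) _) (ψK-cong d a (ι-iter d a n q))

  semiconjugate-orbit : ∀ {f g α} → Congruent₁ f → (∀ w → f (α * w) ≈ α * g w) →
                        ∀ j → iter j f 0# ≈ α * iter j g 0#
  semiconjugate-orbit f-cong semiconj zero    = sym (zeroʳ _)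
  semiconjugate-orbit f-cong semiconj (suc j) = trans (f-cong (semiconjugate-orbit f-cong semiconj j)) (semiconj _)

  semiconjugate-0-preperiodic : ∀ {d a g α} n → Congruent₁ g → g (g (g 0#)) ≈ g (g 0#) →
                                (∀ w → iter (suc n) (ψK K d a) (α * w) ≈ α * g w) → Preperiodic d a 0ℚ
  semiconjugate-0-preperiodic {d} {a} {g} {α} n g-cong g-preperiodic semiconj =
    2 ℕ.* m , m , s≤s z≤n , ι-injective _ _ (begin
      ι (iter (2 ℕ.* m ℕ.+ m) (ψℚ d a) 0ℚ)  ≡⟨ ≡.cong (λ j → ι (iter j (ψℚ d a) 0ℚ)) (ℕP.+-comm (2 ℕ.* m) m) ⟩
      ι (iter (3 ℕ.* m) (ψℚ d a) 0ℚ)        ≈⟨ ι-orbit 3 ⟩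
      iter 3 f 0#                           ≈⟨ orbit 3 ⟩
      α * g (g (g 0#))                      ≈⟨ *-congˡ g-preperiodic ⟩
      α * g (g 0#)                          ≈⟨ orbit 2 ⟨
      iter 2 f 0#                           ≈⟨ ι-orbit 2 ⟨
      ι (iter (2 ℕ.* m) (ψℚ d a) 0ℚ)        ∎)
    where
    m : ℕ
    m = suc n
    f : Fn
    f = iter m (ψK K d a)
    orbit : ∀ j → iter j f 0# ≈ α * iter j g 0#
    orbit = semiconjugate-orbit (iter-cong m (ψK-cong d a)) semiconj
    ι-orbit : ∀ j → ι (iter (j ℕ.* m) (ψℚ d a) 0ℚ) ≈ iter j f 0#
    ι-orbit j = trans (ι-iter d a (j ℕ.* m) 0ℚ)
                      (trans (iter-cong (j ℕ.* m) (ψK-cong d a) ι-0) (reflexive (iter-* (ψK K d a) j m 0#)))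

  ψ-iterate-not-conjugate : ∀ {d a} → 2 ≤ d → InP d a → ¬ Preperiodic d a 0ℚ →
    ∀ n {k e g} → LeadingTerms k e 0# g → e ≉ 0# → Congruent₁ g → g (g (g 0#)) ≈ g (g 0#) →
    ¬ Conjugate F (iter (suc n) (ψK K d a)) g
  ψ-iterate-not-conjugate {d} {a} 2≤d a∈P 0∉Prep n shg e≉0 g-cong g-preperiodic conj =
    0∉Prep (semiconjugate-0-preperiodic {d} {a} n g-cong g-preperiodic (proj₂
      (conjugate⇒semiconjugate (iterate-depressed n (ψ-depressed 2≤d a∈P)) shg e≉0
        (iter-cong (suc n) (ψK-cong d a)) conj)))

lemma4p2 : ∀ {c ℓ : Level} (K : AlgClosureℚ c ℓ) (d : ℕ) → 2 ≤ d →
    (a : Fin (ℕ.suc d) → ℤ) → InP d a → ¬ Preperiodic d a 0ℚ →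
    ∀ (n : ℕ) → 1 ≤ n →
      (∀ (m : ℕ) → 1 ≤ m →
        ¬ Conjugate (AlgClosureℚ.F K) (iter n (ψK K d a)) (λ z → pow (AlgClosureℚ.F K) z m))
      × (∀ (l : ℕ) → 1 ≤ l →
        ¬ Conjugate (AlgClosureℚ.F K) (iter n (ψK K d a)) (cheb (AlgClosureℚ.F K) l))
      × (∀ (l : ℕ) → 1 ≤ l →
        ¬ Conjugate (AlgClosureℚ.F K) (iter n (ψK K d a))
            (λ z → CommutativeRing.-_ (AlgClosureℚ.F K) (cheb (AlgClosureℚ.F K) l z)))
lemma4p2 K d 2≤d a a∈P 0∉Prep (suc n) _ =
    (λ { (suc k) _ → ψ-iterate-not-conjugate 2≤d a∈P 0∉Prep n (leadingTerms-monomial k) 1≉0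
                       (pow-cong (suc k)) (monomial-0-preperiodic k) })
  , (λ { (suc k) _ → ψ-iterate-not-conjugate 2≤d a∈P 0∉Prep n (leadingTerms-cheb k) 1≉0
                       (cheb-cong (suc k)) (cheb-0-preperiodic (suc k)) })
  , (λ { (suc k) _ → ψ-iterate-not-conjugate 2≤d a∈P 0∉Prep n (leadingTerms-neg-cheb k) -1≉0
                       (-‿cong ∘ cheb-cong (suc k)) (neg-cheb-0-preperiodic (suc k)) })
  where
  open Polynomials K
  open AlgClosureℚ K using (F) renaming (nontrivial to 1≉0)
  open CommutativeRing F using (-‿cong)
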